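{- Let $k>2$ and $n\ge 4$ be integers. Then \[ \gamma_{[k]R}(C_9 \Box P_n) \le 9 (n-2)\left\lceil\frac{k+4}{5}\right\rceil + 18\left\lceil \frac{k+3-\left\lceil\frac{k+4}{5}\right\rceil}{3} \right\rceil \le \frac{9nk+81n+6k-6}{5}. \]
   Context: All graphs are finite and simple. For a vertex $v$ of a graph $G$, $N(v)$ denotes its open neighborhood and $N[v]=N(v)\cup\{v\}$ its closed neighborhood. For $f:V(G)\to\mathbb{N}_0$ and $S\subseteq V(G)$ write $f(S)=\sum_{u\in S}f(u)$. For a positive integer $k$, a $[k]$-Roman dominating function of $G$ is a function $f:V(G)\to\{0,1,\dots,k+1\}$ such that every vertex $v$ with $f(v)<k$ satisfies $f(N[v])\ge k+|AN(v)|$, where $AN(v)=\{u\in N(v): f(u)>0\}$. The $[k]$-Roman domination number $\gamma_{[k]R}(G)$ is the minimum of $f(V(G))$ over all $[k]$-Roman dominating functions $f$ of $G$. $C_m\Box P_n$ denotes the Cartesian product of the cycle $C_m$ ($m\ge3$) and the path $P_n$ on $n$ vertices: its vertices are pairs $(i,j)$ with $i\in\{0,\dots,m-1\}$, $j\in\{0,\dots,n-1\}$, and $(i,j)$ is adjacent to $(i',j')$ iff either $j=j'$ and $i-i'\equiv\pm1\pmod m$, or $i=i'$ and $|j-j'|=1$. -}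

module Defs where

open import Data.Nat using (ℕ; zero; suc; _+_; _*_; _∸_; _≤_; _<_; _/_; _%_; _≡ᵇ_; _<ᵇ_)
open import Data.Bool using (Bool; true; false; _∧_; _∨_; if_then_else_)
open import Data.Fin using (Fin; toℕ)
open import Data.List using (List; allFin; concatMap; map)
open import Data.Nat.ListAction using (sum)
open import Data.Product using (_×_; _,_; proj₁; proj₂)

-- ceiling of a / b for b = suc b' (b > 0):  ⌈a/b⌉ = (a + b - 1) / b
⌈_/suc_⌉ : ℕ → ℕ → ℕ
⌈ a /suc b ⌉ = (a + b) / suc b

Vtx : ℕ → ℕ → Set
Vtx m n = Fin m × Fin n

cycAdj : {m : ℕ} → Fin m → Fin m → Bool
cycAdj {m} i i' = (toℕ i ≡ᵇ ((toℕ i' + 1) % suc (m ∸ 1)))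
                ∨ (toℕ i' ≡ᵇ ((toℕ i + 1) % suc (m ∸ 1)))

pathAdj : {n : ℕ} → Fin n → Fin n → Bool
pathAdj j j' = (suc (toℕ j) ≡ᵇ toℕ j') ∨ (suc (toℕ j') ≡ᵇ toℕ j)

adj : {m n : ℕ} → Vtx m n → Vtx m n → Bool
adj (i , j) (i' , j') =
  ((toℕ j ≡ᵇ toℕ j') ∧ cycAdj i i') ∨ ((toℕ i ≡ᵇ toℕ i') ∧ pathAdj j j')

vertices : (m n : ℕ) → List (Vtx m n)
vertices m n = concatMap (λ i → map (λ j → (i , j)) (allFin n)) (allFin m)

weight : {m n : ℕ} → (Vtx m n → ℕ) → ℕ
weight {m} {n} f = sum (map f (vertices m n))

closedNbhdSum : {m n : ℕ} → (Vtx m n → ℕ) → Vtx m n → ℕ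
closedNbhdSum {m} {n} f v =
  f v + sum (map (λ u → if adj v u then f u else 0) (vertices m n))

activeNbrs : {m n : ℕ} → (Vtx m n → ℕ) → Vtx m n → ℕ
activeNbrs {m} {n} f v =
  sum (map (λ u → if adj v u ∧ (0 <ᵇ f u) then 1 else 0) (vertices m n))

record IsKRDF (k m n : ℕ) (f : Vtx m n → ℕ) : Set where
  field
    bounded   : ∀ v → f v ≤ k + 1
    dominates : ∀ v → f v < k → k + activeNbrs f v ≤ closedNbhdSum f v

-- γ_{[k]R}(C_m □ P_n) ≤ b  (γ is a minimum, so this means some [k]RDF has weight ≤ b)
γ[_]R-C_□P_≤_ : ℕ → ℕ → ℕ → ℕ → Set
γ[ k ]R-C m □P n ≤ b = Data.Product.Σ (Vtx m n → ℕ) (λ f → IsKRDF k m n f × weight f ≤ b)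

{-# OPTIONS --safe #-}
module Submission where

-- Label the two end columns of C₉ □ Pₙ with d = ⌈(k+3−c)/3⌉ and all other columns with
-- c = ⌈(k+4)/5⌉.  Every label is positive, so AN(v) = N(v) and the [k]-Roman condition at v
-- becomes k ≤ f(v) + Σ_{u ∈ N(v)} (f(u) − 1).  An inner vertex has four neighbours of label ≥ c,
-- which needs 5c − 4 ≥ k; an end vertex has its two cycle neighbours of label d and one path
-- neighbour of label ≥ c, which needs 3d + c − 3 ≥ k.  The two ceilings are chosen to be the least
-- values meeting these conditions, c ≤ d ≤ k + 1 holds once k ≥ 3, and the labelling weighs
-- 9(n−2)c + 18d.  The construction works for every n ≥ 2; the closed-form bound is linear
-- arithmetic from 5c ≤ k + 8 and 3d + c ≤ k + 5.

open import Data.Bool using (Bool; true; false; _∧_; _∨_; if_then_else_)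
open import Data.Bool.Properties using (∧-zeroʳ; ∨-zeroʳ)
open import Data.Fin using (Fin; zero; suc; toℕ)
open import Data.Fin.Properties using (toℕ<n)
open import Data.List using (List; []; _∷_; _++_; map; tabulate; concatMap; allFin)
open import Data.List.Properties using (map-++; map-cong; map-∘; map-tabulate; tabulate-cong)
open import Data.Nat using (ℕ; zero; suc; _+_; _*_; _∸_; _≤_; _<_; _>_; _≡ᵇ_; _<ᵇ_; z≤n; s≤s; z<s)
open import Data.Nat.DivMod using (_%_; m≡m%n+[m/n]*n; m%n<n; m/n*n≤m)
open import Data.Nat.ListAction using (sum)
open import Data.Nat.ListAction.Properties using (sum-++)
open import Data.Nat.Properties
open import Algebra.Properties.CommutativeSemigroup +-commutativeSemigroup using (interchange)
open import Data.Nat.Tactic.RingSolver using (solve)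
open import Data.Product using (_×_; _,_; proj₂)
open import Relation.Binary.PropositionalEquality
open import Relation.Nullary.Reflects using (ofʸ; ofⁿ)

open import Defs

module _ {A : Set} where

  sum-map-+ : (g h : A → ℕ) (xs : List A) →
              sum (map (λ x → g x + h x) xs) ≡ sum (map g xs) + sum (map h xs)
  sum-map-+ g h []       = refl
  sum-map-+ g h (x ∷ xs) =
    trans (cong (g x + h x +_) (sum-map-+ g h xs)) (interchange (g x) (h x) _ _)

  sum-map-mono : {g h : A → ℕ} → (∀ x → g x ≤ h x) → (xs : List A) → sum (map g xs) ≤ sum (map h xs)
  sum-map-mono g≤h []       = z≤n
  sum-map-mono g≤h (x ∷ xs) = +-mono-≤ (g≤h x) (sum-map-mono g≤h xs)

sum-map-concatMap : ∀ {A B : Set} (g : B → ℕ) (F : A → List B) (xs : List A) →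
                    sum (map g (concatMap F xs)) ≡ sum (map (λ x → sum (map g (F x))) xs)
sum-map-concatMap g F []       = refl
sum-map-concatMap g F (x ∷ xs) = begin
  sum (map g (F x ++ concatMap F xs))              ≡⟨ cong sum (map-++ g (F x) _) ⟩
  sum (map g (F x) ++ map g (concatMap F xs))      ≡⟨ sum-++ (map g (F x)) _ ⟩
  sum (map g (F x)) + sum (map g (concatMap F xs)) ≡⟨ cong (sum (map g (F x)) +_) (sum-map-concatMap g F xs) ⟩
  sum (map g (F x)) + sum (map (λ x → sum (map g (F x))) xs) ∎
  where open ≡-Reasoning

sum-map-allFin : ∀ {n} (g : Fin n → ℕ) → sum (map g (allFin n)) ≡ sum (tabulate g)
sum-map-allFin g = cong sum (map-tabulate (λ j → j) g)

≤-sum-tabulate-toℕ : ∀ {n} (G : ℕ → ℕ) {p} → p < n → G p ≤ sum (tabulate {n = n} (λ j → G (toℕ j)))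
≤-sum-tabulate-toℕ {suc n} G {zero}  _         = m≤m+n (G 0) _
≤-sum-tabulate-toℕ {suc n} G {suc p} (s≤s p<n) =
  ≤-trans (≤-sum-tabulate-toℕ (λ x → G (suc x)) p<n) (m≤n+m _ (G 0))

+-≤-sum-tabulate-toℕ : ∀ {n} (G : ℕ → ℕ) {p q} → p < q → q < n →
                       G p + G q ≤ sum (tabulate {n = n} (λ j → G (toℕ j)))
+-≤-sum-tabulate-toℕ {suc n} G {zero}  {suc q} _         (s≤s q<n) =
  +-monoʳ-≤ (G 0) (≤-sum-tabulate-toℕ (λ x → G (suc x)) q<n)
+-≤-sum-tabulate-toℕ {suc n} G {suc p} {suc q} (s≤s p<q) (s≤s q<n) =
  ≤-trans (+-≤-sum-tabulate-toℕ (λ x → G (suc x)) p<q q<n) (m≤n+m _ (G 0))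

sum-vertices : ∀ {m n} (g : Vtx m n → ℕ) →
               sum (map g (vertices m n)) ≡ sum (map (λ i → sum (tabulate (λ j → g (i , j)))) (allFin m))
sum-vertices {m} {n} g = trans (sum-map-concatMap g _ (allFin m)) (cong sum (map-cong inner (allFin m)))
  where
  inner : ∀ i → sum (map g (map (i ,_) (allFin n))) ≡ sum (tabulate (λ j → g (i , j)))
  inner i = trans (cong sum (sym (map-∘ (allFin n)))) (sum-map-allFin (λ j → g (i , j)))

m≤[1+n]*⌈m/1+n⌉ : ∀ m n → m ≤ suc n * ⌈ m /suc n ⌉
m≤[1+n]*⌈m/1+n⌉ m n = +-cancelʳ-≤ n m _ (begin
  m + n                       ≡⟨ m≡m%n+[m/n]*n (m + n) (suc n) ⟩
  (m + n) % suc n + q * suc n ≤⟨ +-monoˡ-≤ (q * suc n) (≤-pred (m%n<n (m + n) (suc n))) ⟩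
  n + q * suc n               ≡⟨ +-comm n (q * suc n) ⟩
  q * suc n + n               ≡⟨ cong (_+ n) (*-comm q (suc n)) ⟩
  suc n * q + n               ∎)
  where
  open ≤-Reasoning
  q = ⌈ m /suc n ⌉

[1+n]*⌈m/1+n⌉≤m+n : ∀ m n → suc n * ⌈ m /suc n ⌉ ≤ m + n
[1+n]*⌈m/1+n⌉≤m+n m n = subst (_≤ m + n) (*-comm ⌈ m /suc n ⌉ (suc n)) (m/n*n≤m (m + n) (suc n))

m≤[1+n]*⌈m∸o/1+n⌉+o : ∀ {m o} n → o ≤ m → m ≤ suc n * ⌈ m ∸ o /suc n ⌉ + o
m≤[1+n]*⌈m∸o/1+n⌉+o {m} {o} n o≤m = begin
  m                                ≡⟨ m∸n+n≡m o≤m ⟨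
  m ∸ o + o                        ≤⟨ +-monoˡ-≤ o (m≤[1+n]*⌈m/1+n⌉ (m ∸ o) n) ⟩
  suc n * ⌈ m ∸ o /suc n ⌉ + o     ∎
  where open ≤-Reasoning

[1+n]*⌈m∸o/1+n⌉+o≤m+n : ∀ {m o} n → o ≤ m → suc n * ⌈ m ∸ o /suc n ⌉ + o ≤ m + n
[1+n]*⌈m∸o/1+n⌉+o≤m+n {m} {o} n o≤m = begin
  suc n * ⌈ m ∸ o /suc n ⌉ + o     ≤⟨ +-monoˡ-≤ o ([1+n]*⌈m/1+n⌉≤m+n (m ∸ o) n) ⟩
  m ∸ o + n + o                    ≡⟨ +-assoc (m ∸ o) n o ⟩
  m ∸ o + (n + o)                  ≡⟨ cong (m ∸ o +_) (+-comm n o) ⟩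
  m ∸ o + (o + n)                  ≡⟨ +-assoc (m ∸ o) o n ⟨
  m ∸ o + o + n                    ≡⟨ cong (_+ n) (m∸n+n≡m o≤m) ⟩
  m + n                            ∎
  where open ≤-Reasoning

indicator-split : ∀ b {x} → 0 < x →
                  (if b then x else 0) ≡ (if b ∧ (0 <ᵇ x) then 1 else 0) + (if b then x ∸ 1 else 0)
indicator-split false _       = refl
indicator-split true  (s≤s _) = refl

excess : ∀ {m n} → (Vtx m n → ℕ) → Vtx m n → ℕ
excess {m} {n} f v = sum (map (λ u → if adj v u then f u ∸ 1 else 0) (vertices m n))

dominates-if-positive : ∀ {k m n} (f : Vtx m n → ℕ) → (∀ u → 0 < f u) → ∀ v →
                        k ≤ f v + excess f v → k + activeNbrs f v ≤ closedNbhdSum f v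
dominates-if-positive {k} {m} {n} f f>0 v k≤ = begin
  k + activeNbrs f v                  ≤⟨ +-monoˡ-≤ _ k≤ ⟩
  f v + excess f v + activeNbrs f v   ≡⟨ +-assoc (f v) _ _ ⟩
  f v + (excess f v + activeNbrs f v) ≡⟨ cong (f v +_) (+-comm (excess f v) _) ⟩
  f v + (activeNbrs f v + excess f v) ≡⟨ cong (f v +_) split ⟨
  closedNbhdSum f v                   ∎
  where
  open ≤-Reasoning
  split : sum (map (λ u → if adj v u then f u else 0) (vertices m n)) ≡ activeNbrs f v + excess f v
  split = trans (cong sum (map-cong (λ u → indicator-split (adj v u) (f>0 u)) (vertices m n)))
                (sum-map-+ _ _ (vertices m n))

-- pathAdj j j' is definitionally pathNbr (toℕ j) (toℕ j').
pathNbr : ℕ → ℕ → Bool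
pathNbr x y = (suc x ≡ᵇ y) ∨ (suc y ≡ᵇ x)

pathNbrSum : (n : ℕ) → (ℕ → ℕ) → ℕ → ℕ
pathNbrSum n h x = sum (tabulate {n = n} (λ j → if pathNbr x (toℕ j) then h (toℕ j) else 0))

≡ᵇ-refl : ∀ x → (x ≡ᵇ x) ≡ true
≡ᵇ-refl zero    = refl
≡ᵇ-refl (suc x) = ≡ᵇ-refl x

pathNbr-suc : ∀ x → pathNbr x (suc x) ≡ true
pathNbr-suc x = cong (_∨ (suc (suc x) ≡ᵇ x)) (≡ᵇ-refl x)

pathNbr-pred : ∀ x → pathNbr (suc x) x ≡ true
pathNbr-pred x = trans (cong ((suc (suc x) ≡ᵇ x) ∨_) (≡ᵇ-refl x)) (∨-zeroʳ _)

pathNbrSum-≥ : ∀ {n} h {x y} → y < n → pathNbr x y ≡ true → h y ≤ pathNbrSum n h x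
pathNbrSum-≥ h {x} y<n x~y =
  ≤-trans (≤-reflexive (cong (if_then _ else 0) (sym x~y)))
          (≤-sum-tabulate-toℕ (λ y → if pathNbr x y then h y else 0) y<n)

pathNbrSum-≥₂ : ∀ {n} h {x y z} → y < z → z < n → pathNbr x y ≡ true → pathNbr x z ≡ true →
                h y + h z ≤ pathNbrSum n h x
pathNbrSum-≥₂ h {x} y<z z<n x~y x~z =
  ≤-trans (≤-reflexive (cong₂ _+_ (cong (if_then _ else 0) (sym x~y)) (cong (if_then _ else 0) (sym x~z))))
          (+-≤-sum-tabulate-toℕ (λ y → if pathNbr x y then h y else 0) y<z z<n)

columnwise : ∀ {m n} → (ℕ → ℕ) → Vtx m n → ℕ
columnwise h (_ , j) = h (toℕ j)

-- Row i of the neighbour sum at (i₀ , x), with b₁ = cycAdj i₀ i and b₂ = (i₀ ≟ i); never both hold.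
column-neighbourSum : ∀ {n} (h : ℕ → ℕ) {x} → x < n → ∀ b₁ b₂ →
  (if b₁ then h x else if b₂ then pathNbrSum n h x else 0)
    ≤ sum (tabulate {n = n} (λ j → if ((x ≡ᵇ toℕ j) ∧ b₁) ∨ (b₂ ∧ pathNbr x (toℕ j)) then h (toℕ j) else 0))
column-neighbourSum h {x} x<n true b₂ =
  ≤-trans (≤-reflexive (cong (λ b → if (b ∧ true) ∨ (b₂ ∧ pathNbr x x) then h x else 0) (sym (≡ᵇ-refl x))))
          (≤-sum-tabulate-toℕ (λ y → if ((x ≡ᵇ y) ∧ true) ∨ (b₂ ∧ pathNbr x y) then h y else 0) x<n)
column-neighbourSum {n} h {x} x<n false true = ≤-reflexive (cong sum (tabulate-cong {n = n} λ j →
  cong (λ b → if b ∨ pathNbr x (toℕ j) then h (toℕ j) else 0) (sym (∧-zeroʳ (x ≡ᵇ toℕ j)))))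
column-neighbourSum h x<n false false = z≤n

module _ (X P : ℕ) where
  private
    P+[X+[X+0]]≡X+X+P : P + (X + (X + 0)) ≡ X + X + P
    P+[X+[X+0]]≡X+X+P = solve (X ∷ P ∷ [])
    X+[P+[X+0]]≡X+X+P : X + (P + (X + 0)) ≡ X + X + P
    X+[P+[X+0]]≡X+X+P = solve (X ∷ P ∷ [])
    X+[X+[P+0]]≡X+X+P : X + (X + (P + 0)) ≡ X + X + P
    X+[X+[P+0]]≡X+X+P = solve (X ∷ P ∷ [])

  C₉-cycle-count : ∀ (i₀ : Fin 9) →
    sum (map (λ i → if cycAdj i₀ i then X else if toℕ i₀ ≡ᵇ toℕ i then P else 0) (allFin 9)) ≡ X + X + P
  C₉-cycle-count zero = P+[X+[X+0]]≡X+X+P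
  C₉-cycle-count (suc zero) = X+[P+[X+0]]≡X+X+P
  C₉-cycle-count (suc (suc zero)) = X+[P+[X+0]]≡X+X+P
  C₉-cycle-count (suc (suc (suc zero))) = X+[P+[X+0]]≡X+X+P
  C₉-cycle-count (suc (suc (suc (suc zero)))) = X+[P+[X+0]]≡X+X+P
  C₉-cycle-count (suc (suc (suc (suc (suc zero))))) = X+[P+[X+0]]≡X+X+P
  C₉-cycle-count (suc (suc (suc (suc (suc (suc zero)))))) = X+[P+[X+0]]≡X+X+P
  C₉-cycle-count (suc (suc (suc (suc (suc (suc (suc zero))))))) = X+[P+[X+0]]≡X+X+P
  C₉-cycle-count (suc (suc (suc (suc (suc (suc (suc (suc zero)))))))) = X+[X+[P+0]]≡X+X+P

C₉-columnwise-neighbourSum : ∀ {n} (h : ℕ → ℕ) (v : Vtx 9 n) →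
  let x = toℕ (proj₂ v) in
  h x + h x + pathNbrSum n h x ≤ sum (map (λ u → if adj v u then columnwise h u else 0) (vertices 9 n))
C₉-columnwise-neighbourSum {n} h (i₀ , j₀) = begin
  h x + h x + P
    ≡⟨ C₉-cycle-count (h x) P i₀ ⟨
  sum (map (λ i → if cycAdj i₀ i then h x else if toℕ i₀ ≡ᵇ toℕ i then P else 0) (allFin 9))
    ≤⟨ sum-map-mono (λ i → column-neighbourSum h (toℕ<n j₀) (cycAdj i₀ i) (toℕ i₀ ≡ᵇ toℕ i)) (allFin 9) ⟩
  sum (map (λ i → sum (tabulate (λ j → if adj (i₀ , j₀) (i , j) then columnwise h (i , j) else 0))) (allFin 9))
    ≡⟨ sum-vertices (λ u → if adj (i₀ , j₀) u then columnwise h u else 0) ⟨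
  sum (map (λ u → if adj (i₀ , j₀) u then columnwise h u else 0) (vertices 9 n)) ∎
  where
  open ≤-Reasoning
  x = toℕ j₀
  P = pathNbrSum n h x

end-column-condition : ∀ {k c d P} → 0 < c → 0 < d → k + 3 ≤ 3 * d + c → c ∸ 1 ≤ P →
                       k ≤ d + (d ∸ 1 + (d ∸ 1) + P)
end-column-condition {k} {suc c} {suc d} {P} _ _ k+3≤ c≤P = +-cancelʳ-≤ 3 k _ (begin
  k + 3                         ≤⟨ k+3≤ ⟩
  3 * suc d + suc c             ≡⟨ solve (c ∷ d ∷ []) ⟩
  suc d + (d + d + c) + 3       ≤⟨ +-monoˡ-≤ 3 (+-monoʳ-≤ (suc d) (+-monoʳ-≤ (d + d) c≤P)) ⟩
  suc d + (d + d + P) + 3       ∎)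
  where open ≤-Reasoning

inner-column-condition : ∀ {k c P} → 0 < c → k + 4 ≤ 5 * c → c ∸ 1 + (c ∸ 1) ≤ P →
                         k ≤ c + (c ∸ 1 + (c ∸ 1) + P)
inner-column-condition {k} {suc c} {P} _ k+4≤ 2c≤P = +-cancelʳ-≤ 4 k _ (begin
  k + 4                         ≤⟨ k+4≤ ⟩
  5 * suc c                     ≡⟨ solve (c ∷ []) ⟩
  suc c + (c + c + (c + c)) + 4 ≤⟨ +-monoˡ-≤ 4 (+-monoʳ-≤ (suc c) (+-monoʳ-≤ (c + c) 2c≤P)) ⟩
  suc c + (c + c + P) + 4       ∎)
  where open ≤-Reasoning

column : (m c d : ℕ) → ℕ → ℕ
column m c d zero    = d
column m c d (suc x) = if x <ᵇ m then c else d

column-≥ : ∀ {m c d} → c ≤ d → ∀ x → c ≤ column m c d x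
column-≥ c≤d zero = c≤d
column-≥ {m} c≤d (suc x) with x <ᵇ m
... | true  = ≤-refl
... | false = c≤d

column-≤ : ∀ {m c d} → c ≤ d → ∀ x → column m c d x ≤ d
column-≤ c≤d zero = ≤-refl
column-≤ {m} c≤d (suc x) with x <ᵇ m
... | true  = c≤d
... | false = ≤-refl

sum-column : ∀ m c d → sum (tabulate {n = 2 + m} (λ j → column m c d (toℕ j))) ≡ d + (m * c + d)
sum-column m c d = cong (d +_) (inner m)
  where
  inner : ∀ m → sum (tabulate {n = suc m} (λ j → if toℕ j <ᵇ m then c else d)) ≡ m * c + d
  inner zero    = +-identityʳ d
  inner (suc m) = trans (cong (c +_) (inner m)) (sym (+-assoc c (m * c) d))

C₉□P-column-RDF : ∀ {k m c d} → 0 < c → c ≤ d → d ≤ k + 1 → k + 4 ≤ 5 * c → k + 3 ≤ 3 * d + c →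
                  γ[ k ]R-C 9 □P (2 + m) ≤ (9 * m * c + 18 * d)
C₉□P-column-RDF {k} {m} {c} {d} c>0 c≤d d≤k+1 k+4≤5c k+3≤3d+c =
  f , record { bounded = bounded ; dominates = λ v _ → dominates v } , ≤-reflexive weight-f
  where
  f : Vtx 9 (2 + m) → ℕ
  f = columnwise (column m c d)

  W : ℕ → ℕ
  W y = column m c d y ∸ 1

  W≥ : ∀ y → c ∸ 1 ≤ W y
  W≥ y = ∸-monoˡ-≤ 1 (column-≥ c≤d y)

  column-condition : ∀ x → x < 2 + m → k ≤ column m c d x + (W x + W x + pathNbrSum (2 + m) W x)
  column-condition zero _ = end-column-condition c>0 (≤-trans c>0 c≤d) k+3≤3d+c
    (≤-trans (W≥ 1) (pathNbrSum-≥ {2 + m} W {0} (s≤s (s≤s z≤n)) (pathNbr-suc 0)))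
  column-condition (suc x) x<n with x <ᵇ m | <ᵇ-reflects-< x m
  ... | true  | ofʸ x<m = inner-column-condition c>0 k+4≤5c
    (≤-trans (+-mono-≤ (W≥ x) (W≥ (2 + x)))
             (pathNbrSum-≥₂ {2 + m} W {suc x} (<-trans (n<1+n x) (n<1+n (suc x))) (s≤s (s≤s x<m))
                            (pathNbr-pred x) (pathNbr-suc (suc x))))
  ... | false | ofⁿ _   = end-column-condition c>0 (≤-trans c>0 c≤d) k+3≤3d+c
    (≤-trans (W≥ x) (pathNbrSum-≥ {2 + m} W {suc x} (<-trans (n<1+n x) x<n) (pathNbr-pred x)))

  bounded : ∀ v → f v ≤ k + 1
  bounded (_ , j) = ≤-trans (column-≤ c≤d (toℕ j)) d≤k+1

  dominates : ∀ v → k + activeNbrs f v ≤ closedNbhdSum f v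
  dominates v@(_ , j) = dominates-if-positive f (λ (_ , j) → ≤-trans c>0 (column-≥ c≤d (toℕ j))) v
    (≤-trans (column-condition (toℕ j) (toℕ<n j)) (+-monoʳ-≤ (f v) (C₉-columnwise-neighbourSum W v)))

  weight-f : weight f ≡ 9 * m * c + 18 * d
  weight-f = begin
    -- the nine equal row sums add up to 9 * _ by evaluation
    weight f                                                    ≡⟨ sum-vertices f ⟩
    9 * sum (tabulate {n = 2 + m} (λ j → column m c d (toℕ j))) ≡⟨ cong (9 *_) (sum-column m c d) ⟩
    9 * (d + (m * c + d))                                       ≡⟨ solve (m ∷ c ∷ d ∷ []) ⟩
    9 * m * c + 18 * d                                          ∎
    where open ≡-Reasoning

inner≤end : ∀ {k c d} → 2 < k → 5 * c ≤ k + 8 → k + 3 ≤ 3 * d + c → c ≤ d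
inner≤end {k} {c} {d} 2<k 5c≤k+8 k+3≤3d+c = ≮⇒≥ λ d<c → <⇒≱ (4[k+8]<5[k+6] 2<k) (begin
  5 * (k + 6)           ≡⟨ solve (k ∷ []) ⟩
  5 * (k + 3) + 15      ≤⟨ +-monoˡ-≤ 15 (*-monoʳ-≤ 5 k+3≤3d+c) ⟩
  5 * (3 * d + c) + 15  ≡⟨ solve (d ∷ c ∷ []) ⟩
  15 * (1 + d) + 5 * c  ≤⟨ +-monoˡ-≤ (5 * c) (*-monoʳ-≤ 15 d<c) ⟩
  15 * c + 5 * c        ≡⟨ solve (c ∷ []) ⟩
  4 * (5 * c)           ≤⟨ *-monoʳ-≤ 4 5c≤k+8 ⟩
  4 * (k + 8)           ∎)
  where
  open ≤-Reasoning
  4[k+8]<5[k+6] : ∀ {k} → 2 < k → 4 * (k + 8) < 5 * (k + 6)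
  4[k+8]<5[k+6] {suc (suc (suc t))} (s≤s (s≤s (s≤s _))) =
    ≤-trans (m≤n+m _ t) (≤-reflexive (solve (t ∷ [])))

end≤k+1 : ∀ {k c d} → 2 < k → 0 < c → 3 * d + c ≤ k + 5 → d ≤ k + 1
end≤k+1 {k} {c} {d} 2<k 0<c 3d+c≤k+5 = *-cancelˡ-≤ 3 (begin
  3 * d         ≤⟨ +-cancelʳ-≤ 1 (3 * d) (k + 4) (begin
                     3 * d + 1    ≤⟨ +-monoʳ-≤ (3 * d) 0<c ⟩
                     3 * d + c    ≤⟨ 3d+c≤k+5 ⟩
                     k + 5        ≡⟨ +-assoc k 4 1 ⟨
                     k + 4 + 1    ∎) ⟩
  k + 4         ≤⟨ k+4≤3[k+1] 2<k ⟩
  3 * (k + 1)   ∎)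
  where
  open ≤-Reasoning
  k+4≤3[k+1] : ∀ {k} → 2 < k → k + 4 ≤ 3 * (k + 1)
  k+4≤3[k+1] {suc (suc (suc t))} (s≤s (s≤s (s≤s _))) =
    ≤-trans (m≤m+n _ (2 * t + 5)) (≤-reflexive (solve (t ∷ [])))

5B≤9nk+81n+6k∸6 : ∀ {k m c d} → k + 4 ≤ 5 * c → 5 * c ≤ k + 8 → 3 * d + c ≤ k + 5 →
                  5 * (9 * m * c + 18 * d) ≤ 9 * (2 + m) * k + 81 * (2 + m) + 6 * k ∸ 6
5B≤9nk+81n+6k∸6 {k} {m} {c} {d} k+4≤5c 5c≤k+8 3d+c≤k+5 =
  m+n≤o⇒m≤o∸n _ {o = 9 * (2 + m) * k + 81 * (2 + m) + 6 * k} (+-cancelʳ-≤ (6 * (k + 4)) _ _ (begin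
    5 * (9 * m * c + 18 * d) + 6 + 6 * (k + 4)
      ≤⟨ +-monoʳ-≤ (5 * (9 * m * c + 18 * d) + 6) (*-monoʳ-≤ 6 k+4≤5c) ⟩
    5 * (9 * m * c + 18 * d) + 6 + 6 * (5 * c)
      ≡⟨ solve (m ∷ c ∷ d ∷ []) ⟩
    9 * m * (5 * c) + 30 * (3 * d + c) + 6
      ≤⟨ +-monoˡ-≤ 6 (+-mono-≤ (*-monoʳ-≤ (9 * m) 5c≤k+8) (*-monoʳ-≤ 30 3d+c≤k+5)) ⟩
    9 * m * (k + 8) + 30 * (k + 5) + 6
      ≤⟨ m≤m+n _ (9 * m + 30) ⟩
    9 * m * (k + 8) + 30 * (k + 5) + 6 + (9 * m + 30)
      ≡⟨ solve (k ∷ m ∷ []) ⟩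
    9 * (2 + m) * k + 81 * (2 + m) + 6 * k + 6 * (k + 4) ∎))
  where open ≤-Reasoning

module ColumnWeights (k : ℕ) (2<k : 2 < k) where
  c d : ℕ
  c = ⌈ k + 4 /suc 4 ⌉
  d = ⌈ k + 3 ∸ c /suc 2 ⌉

  k+4≤5c : k + 4 ≤ 5 * c
  k+4≤5c = m≤[1+n]*⌈m/1+n⌉ (k + 4) 4

  5c≤k+8 : 5 * c ≤ k + 8
  5c≤k+8 = ≤-trans ([1+n]*⌈m/1+n⌉≤m+n (k + 4) 4) (≤-reflexive (+-assoc k 4 4))

  0<c : 0 < c
  0<c = *-cancelˡ-< 5 0 c (<-≤-trans (<-≤-trans z<s (m≤n+m 4 k)) k+4≤5c)

  c≤k+3 : c ≤ k + 3
  c≤k+3 = *-cancelˡ-≤ 5 (begin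
    5 * c                 ≤⟨ 5c≤k+8 ⟩
    k + 8                 ≤⟨ m≤m+n (k + 8) (4 * k + 7) ⟩
    k + 8 + (4 * k + 7)   ≡⟨ solve (k ∷ []) ⟩
    5 * (k + 3)           ∎)
    where open ≤-Reasoning

  k+3≤3d+c : k + 3 ≤ 3 * d + c
  k+3≤3d+c = m≤[1+n]*⌈m∸o/1+n⌉+o 2 c≤k+3

  3d+c≤k+5 : 3 * d + c ≤ k + 5
  3d+c≤k+5 = ≤-trans ([1+n]*⌈m∸o/1+n⌉+o≤m+n 2 c≤k+3) (≤-reflexive (+-assoc k 3 2))

  c≤d : c ≤ d
  c≤d = inner≤end 2<k 5c≤k+8 k+3≤3d+c

  d≤k+1 : d ≤ k + 1
  d≤k+1 = end≤k+1 2<k 0<c 3d+c≤k+5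

theorem2 : (k n : ℕ) → k > 2 → 4 ≤ n →
    let c = ⌈ k + 4 /suc 4 ⌉
        B = 9 * (n ∸ 2) * c + 18 * ⌈ k + 3 ∸ c /suc 2 ⌉
    in (γ[ k ]R-C 9 □P n ≤ B)
       × (5 * B ≤ 9 * n * k + 81 * n + 6 * k ∸ 6)
theorem2 k (suc (suc m)) 2<k (s≤s (s≤s _)) =
  C₉□P-column-RDF {m = m} 0<c c≤d d≤k+1 k+4≤5c k+3≤3d+c ,
  5B≤9nk+81n+6k∸6 {m = m} {d = d} k+4≤5c 5c≤k+8 3d+c≤k+5
  where open ColumnWeights k 2<k
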